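{- Let $F$ be a forest and $\{M_i\}_{i\in F}$ a collection of MTL-chains sharing the same top element $1$. The presheaf $\mathcal P:\mathrm{Dec}(F)^{op}\to\mathcal{MTL}$ with $\mathcal P(T)=\bigotimes_{i\in T}M_i$ and restriction maps $h\mapsto h|_S$ for $S\subseteq T$ is an MTL-algebra in the category of sheaves on the Alexandrov space $(F,\mathrm{Dec}(F))$; i.e., its underlying presheaf of sets is a sheaf.
   Context: A forest is a poset in which every $\downarrow a$ is totally ordered. $\mathrm{Dec}(F)$ is the set of downsets of $F$, which are the open sets of the Alexandrov topology on $F$. MTL-chains are totally ordered bounded integral commutative prelinear residuated lattices; $\mathcal{MTL}$ is the category of MTL-algebras. The forest product $\bigotimes_{i\in T}M_i$ is the set of functions $h$ on $T$ with $h(i)\in M_i$ such that $h(i)\ne0_i$ implies $h(j)=1$ for all $j<i$ in $T$; monoid and lattice operations pointwise; $(h\to g)(i)=h(i)\to_ig(i)$ if $h(j)\le_jg(j)$ for all $j<i$, else $0_i$. For $S\subseteq T$ downsets, $h|_S$ lies in $\bigotimes_{i\in S}M_i$. -}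

module Defs where

open import Level using (Level; _⊔_) renaming (suc to lsuc)
open import Relation.Binary using (Rel; IsPartialOrder; IsTotalOrder)
open import Relation.Binary.PropositionalEquality using (_≡_; _≢_)
open import Relation.Unary using (Pred; _∈_; _⊆_)
open import Algebra.Structures using (IsCommutativeMonoid)
open import Data.Product using (Σ; _×_; ∃; proj₁; proj₂; _,_)
open import Data.Sum using (_⊎_)
open import Function.Bundles using (_⇔_)

record Forest (a ℓ : Level) : Set (lsuc (a ⊔ ℓ)) where
  field
    Carrier        : Set a
    _≤_            : Rel Carrier ℓ
    isPartialOrder : IsPartialOrder _≡_ _≤_
    ↓-total        : ∀ {z x y} → x ≤ z → y ≤ z → (x ≤ y) ⊎ (y ≤ x)

  _<_ : Rel Carrier (a ⊔ ℓ)
  x < y = (x ≤ y) × (x ≢ y)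

  -- downsets = open sets of the Alexandrov topology Dec(F)
  IsDownset : ∀ {p} → Pred Carrier p → Set (a ⊔ ℓ ⊔ p)
  IsDownset S = ∀ {x y} → y ≤ x → x ∈ S → y ∈ S

record MTLChain (c : Level) : Set (lsuc c) where
  infixl 7 _⊙_
  infixr 5 _⇒_
  field
    Carrier  : Set c
    _≤_      : Rel Carrier c
    _⊙_      : Carrier → Carrier → Carrier
    _⇒_      : Carrier → Carrier → Carrier
    _∧_      : Carrier → Carrier → Carrier
    _∨_      : Carrier → Carrier → Carrier
    𝟘        : Carrier
    𝟙        : Carrier
    isTotalOrder        : IsTotalOrder _≡_ _≤_
    ∧-lb₁    : ∀ x y → (x ∧ y) ≤ x
    ∧-lb₂    : ∀ x y → (x ∧ y) ≤ y
    ∧-glb    : ∀ x y z → z ≤ x → z ≤ y → z ≤ (x ∧ y)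
    ∨-ub₁    : ∀ x y → x ≤ (x ∨ y)
    ∨-ub₂    : ∀ x y → y ≤ (x ∨ y)
    ∨-lub    : ∀ x y z → x ≤ z → y ≤ z → (x ∨ y) ≤ z
    𝟘-least  : ∀ x → 𝟘 ≤ x
    𝟙-greatest : ∀ x → x ≤ 𝟙
    isCommutativeMonoid : IsCommutativeMonoid _≡_ _⊙_ 𝟙
    residuation : ∀ x y z → ((x ⊙ y) ≤ z) ⇔ (x ≤ (y ⇒ z))
    prelinearity : ∀ x y → ((x ⇒ y) ∨ (y ⇒ x)) ≡ 𝟙

-- The forest product ⊗_{i∈T} M_i, for T a downset of F.

module ForestProduct {a ℓ c : Level} (F : Forest a ℓ)
                     (M : Forest.Carrier F → MTLChain c) where
  open Forest F renaming (Carrier to Idx)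
  open MTLChain using (𝟘; 𝟙)

  Fun : ∀ {p} → Pred Idx p → Set (a ⊔ c ⊔ p)
  Fun T = (i : Idx) → i ∈ T → MTLChain.Carrier (M i)

  WellDefined : ∀ {p} (T : Pred Idx p) → Fun T → Set (a ⊔ c ⊔ p)
  WellDefined T h = ∀ i (p q : i ∈ T) → h i p ≡ h i q

  ForestCond : ∀ {p} (T : Pred Idx p) → Fun T → Set (a ⊔ ℓ ⊔ c ⊔ p)
  ForestCond T h = ∀ i (p : i ∈ T) → h i p ≢ 𝟘 (M i) →
                   ∀ j (q : j ∈ T) → j < i → h j q ≡ 𝟙 (M j)

  P : ∀ {p} → Pred Idx p → Set (a ⊔ ℓ ⊔ c ⊔ p)
  P T = Σ (Fun T) λ h → WellDefined T h × ForestCond T h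

  EqOn : ∀ {p} (T : Pred Idx p) → P T → P T → Set (a ⊔ c ⊔ p)
  EqOn T h g = ∀ i (p : i ∈ T) → proj₁ h i p ≡ proj₁ g i p

  restrict : ∀ {p} {S T : Pred Idx p} → S ⊆ T → P T → P S
  restrict {S = S} {T} S⊆T (h , wd , fc) =
    (λ i q → h i (S⊆T q)) ,
    (λ i q q' → wd i (S⊆T q) (S⊆T q')) ,
    (λ i q ne j q' j<i → fc i (S⊆T q) ne j (S⊆T q') j<i)

  IsSheaf : (p : Level) → Set (lsuc p ⊔ a ⊔ ℓ ⊔ c)
  IsSheaf p =
    (T : Pred Idx p) → IsDownset T →
    (I : Set p) (U : I → Pred Idx p) → (∀ k → IsDownset (U k)) →
    (sub : ∀ k → U k ⊆ T) →
    (∀ {i} → i ∈ T → ∃ λ k → i ∈ U k) →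
    (hs : (k : I) → P (U k)) →
    -- compatibility: h_k|_{U_k ∩ U_l} = h_l|_{U_k ∩ U_l}
    (∀ k l i (p : i ∈ U k) (q : i ∈ U l) → proj₁ (hs k) i p ≡ proj₁ (hs l) i q) →
    (Σ (P T) λ h → ∀ k → EqOn (U k) (restrict (sub k) h) (hs k))
    ×
    (∀ (h g : P T) → (∀ k → EqOn (U k) (restrict (sub k) h) (hs k)) →
                     (∀ k → EqOn (U k) (restrict (sub k) g) (hs k)) → EqOn T h g)

module Submission where

-- Elements of P(T) are functions on T, so the sheaf condition splits into
-- locality and gluing, both for an arbitrary cover (U_k)_{k∈I} of T:
--   * locality: two sections of P(T) agreeing on every U_k agree on T, since
--     every point of T lies in some U_k (well-definedness lets us transport
--     along membership proofs);
--   * gluing: a compatible family (h_k) defines a function on T by choosing,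
--     for each i ∈ T, some U_k containing i.  Compatibility makes the choice
--     irrelevant, and the forest condition is inherited from h_k because U_k
--     is a downset: every j < i in T already lies in the same U_k.
-- Only the constants 0 and 1 of the chains M_i enter.
-- The theorem is the conjunction of these two facts.

open import Defs
open import Level using (Level; _⊔_)
open import Data.Product using (∃; proj₁; proj₂; _,_)
open import Relation.Binary.PropositionalEquality using (_≡_; sym; trans)
open import Relation.Unary using (Pred; _∈_; _⊆_)

module SheafCondition {a ℓ c p : Level} (F : Forest a ℓ)
                      (M : Forest.Carrier F → MTLChain c) where
  open Forest F renaming (Carrier to Idx)
  open ForestProduct F M

  Compatible : ∀ {q} {I : Set q} (U : I → Pred Idx p) → ((k : I) → P (U k)) →
               Set (a ⊔ c ⊔ p ⊔ q)
  Compatible U hs =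
    ∀ k l i (u : i ∈ U k) (v : i ∈ U l) → proj₁ (hs k) i u ≡ proj₁ (hs l) i v

  module _ {q} {T : Pred Idx p} {I : Set q} (U : I → Pred Idx p)
           (sub : ∀ k → U k ⊆ T) (cov : ∀ {i} → i ∈ T → ∃ λ k → i ∈ U k) where

    locality : (h g : P T) →
               (∀ k → EqOn (U k) (restrict (sub k) h) (restrict (sub k) g)) →
               EqOn T h g
    locality (h , h-wd , _) (g , g-wd , _) agree i t =
      let (k , u) = cov t
      in trans (h-wd i t (sub k u)) (trans (agree k i u) (g-wd i (sub k u) t))

    gluing-unique : (hs : (k : I) → P (U k)) (h g : P T) →
                    (∀ k → EqOn (U k) (restrict (sub k) h) (hs k)) →
                    (∀ k → EqOn (U k) (restrict (sub k) g) (hs k)) →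
                    EqOn T h g
    gluing-unique hs h g h-restricts g-restricts =
      locality h g λ k i u → trans (h-restricts k i u) (sym (g-restricts k i u))

    module Glue (U-downset : ∀ k → IsDownset (U k))
                (hs : (k : I) → P (U k)) (compatible : Compatible U hs) where

      glued : Fun T
      glued i t = let (k , u) = cov t in proj₁ (hs k) i u

      glued-agrees : ∀ k i (t : i ∈ T) (u : i ∈ U k) → glued i t ≡ proj₁ (hs k) i u
      glued-agrees k i t u = compatible (proj₁ (cov t)) k i (proj₂ (cov t)) u

      glued-wellDefined : WellDefined T glued
      glued-wellDefined i t t' = glued-agrees (proj₁ (cov t')) i t (proj₂ (cov t'))

      -- The forest condition at i is checked inside the single member U_k
      -- chosen for i: as U_k is a downset, every j < i lies in U_k too.
      glued-forestCond : ForestCond T glued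
      glued-forestCond i t nonzero j s j<i =
        let (k , u) = cov t
            j∈Uk = U-downset k (proj₁ j<i) u
        in trans (glued-agrees k j s j∈Uk)
                 (proj₂ (proj₂ (hs k)) i u nonzero j j∈Uk j<i)

      glue : P T
      glue = glued , glued-wellDefined , glued-forestCond

      glue-restricts : ∀ k → EqOn (U k) (restrict (sub k) glue) (hs k)
      glue-restricts k i u = glued-agrees k i (sub k u) u

lemma4p13 : ∀ {a ℓ c : Level} (p : Level) (F : Forest a ℓ)
              (M : Forest.Carrier F → MTLChain c) →
              ForestProduct.IsSheaf F M p
lemma4p13 p F M T _ I U U-downset sub cov hs compatible =
  (glue , glue-restricts) , gluing-unique U sub cov hs
  where
  open SheafCondition {p = p} F M
  open Glue U sub cov U-downset hs compatible
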